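{- Let $m\ge1$, $S_1,\dots,S_k\subseteq\mathbb{Z}_m$, and suppose $\Gamma=\mathrm{DiCay}(\mathbb{Z}_m,S_1,\dots,S_k)$ is reduced. Let $l$ be an integer coprime to $m$. Then $\mathrm{Aut}^{\mathrm{Ch}}(\Gamma)=\mathrm{Aut}^{\mathrm{Ch}}(\Gamma^{(l)})$, and the map $\iota(\psi_l):\varphi\mapsto\psi_l\circ\varphi\circ\psi_l^{ -1}$ is an automorphism of the group $\mathrm{Aut}^{\mathrm{Ch}}(\Gamma)$.
   Context: A colored digraph is $(V,(E_1,\dots,E_k))$ with $V$ finite and arbitrary relations $E_j\subseteq V\times V$. $\mathrm{DiCay}(\mathbb{Z}_m,S_1,\dots,S_k)$ has vertex set $\mathbb{Z}_m$ and $E_i=\{(x,y)\mid y-x\in S_i\}$; it is reduced iff there is no nonzero $h\in\mathbb{Z}_m$ with $S_i+h=S_i$ for all $i$ (equivalently, distinct vertices have distinct colored in-neighbourhoods and distinct colored out-neighbourhoods). $\Gamma^{(l)}=\mathrm{DiCay}(\mathbb{Z}_m,lS_1,\dots,lS_k)$ and $\psi_l(x)=lx$. The chain $\mathrm{Ch}(\Gamma)$ is the infinite colored digraph on $V\times\mathbb{Z}$ with a color-$j$ edge from $(v,i)$ to $(w,i+1)$ iff $(v,w)\in E_j$. $\mathrm{Aut}_{\mathrm{Ch}}(\Gamma)$ is the group of sequences $(\sigma_i)_{i\in\mathbb{Z}}$ of permutations of $V$ such that $(v,i)\mapsto(\sigma_i(v),i)$ is a color-preserving automorphism of $\mathrm{Ch}(\Gamma)$,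 and $\mathrm{Aut}^{\mathrm{Ch}}(\Gamma)=\{\sigma_0\mid(\sigma_i)\in\mathrm{Aut}_{\mathrm{Ch}}(\Gamma)\}$. -}

module Defs where

open import Level using (0ℓ)
open import Data.Nat as ℕ using (ℕ; NonZero)
open import Data.Nat.DivMod using (_mod_)
open import Data.Fin as Fin using (Fin; toℕ)
open import Data.Fin.Subset using (Subset; _∈_)
open import Data.Fin.Permutation using (Permutation′; _⟨$⟩ʳ_; _⟨$⟩ˡ_; _∘ₚ_; flip)
open import Data.Integer as ℤ using (ℤ; +_)
open import Data.Integer.DivMod using (_%ℕ_)
open import Data.Product using (Σ; _×_; _,_; ∃)
open import Relation.Binary.PropositionalEquality using (_≡_)

module _ {m : ℕ} .{{_ : NonZero m}} where

  [_]ₘ : ℤ → Fin m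
  [ z ]ₘ = (z %ℕ m) mod m

  infixl 6 _+ₘ_ _-ₘ_
  _+ₘ_ : Fin m → Fin m → Fin m
  x +ₘ y = [ + toℕ x ℤ.+ + toℕ y ]ₘ

  _-ₘ_ : Fin m → Fin m → Fin m
  x -ₘ y = [ + toℕ x ℤ.- + toℕ y ]ₘ

  0ₘ : Fin m
  0ₘ = [ + 0 ]ₘ

  ψ : ℤ → Fin m → Fin m
  ψ l x = [ l ℤ.* + toℕ x ]ₘ

-- Colored digraphs with k colors on a vertex type V:
-- E j v w  means  (v , w) ∈ E_j.

record ColDigraph (k : ℕ) (V : Set) : Set₁ where
  field
    E : Fin k → V → V → Set
open ColDigraph public

ConnSets : ℕ → ℕ → Set₁
ConnSets k m = Fin k → Fin m → Set

module _ {m : ℕ} .{{_ : NonZero m}} where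

  DiCay : ∀ {k} → ConnSets k m → ColDigraph k (Fin m)
  E (DiCay S) j x y = S j (y -ₘ x)

  asConn : ∀ {k} → (Fin k → Subset m) → ConnSets k m
  asConn S j x = x ∈ S j

  scaleSets : ∀ {k} → ℤ → ConnSets k m → ConnSets k m
  scaleSets l S j y = ∃ λ s → S j s × ψ l s ≡ y

  TranslateInvariant : Subset m → Fin m → Set
  TranslateInvariant S h =
    (∀ s → s ∈ S → (s +ₘ h) ∈ S) × (∀ y → y ∈ S → ∃ λ s → s ∈ S × s +ₘ h ≡ y)

  Reduced : ∀ {k} → (Fin k → Subset m) → Set
  Reduced S = ∀ h → (∀ i → TranslateInvariant (S i) h) → h ≡ 0ₘ

  DiCayScaled : ∀ {k} → ℤ → (Fin k → Subset m) → ColDigraph k (Fin m)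
  DiCayScaled l S = DiCay (scaleSets l (asConn S))

-- (σ_i)_{i∈ℤ} induces a color-preserving automorphism of Ch(Γ):
-- a color-j edge (v,i) → (w,i+1) exists iff one (σ_i v,i) → (σ_{i+1} w,i+1) does.
-- (Level-preserving bijections: edges of Ch(Γ) only join consecutive levels.)
IsChainAut : ∀ {k n} → ColDigraph k (Fin n) → (ℤ → Permutation′ n) → Set
IsChainAut Γ σ = ∀ (i : ℤ) (j : Fin _) v w →
  (E Γ j v w → E Γ j (σ i ⟨$⟩ʳ v) (σ (i ℤ.+ + 1) ⟨$⟩ʳ w)) ×
  (E Γ j (σ i ⟨$⟩ʳ v) (σ (i ℤ.+ + 1) ⟨$⟩ʳ w) → E Γ j v w)

_≈ₚ_ : ∀ {n} → Permutation′ n → Permutation′ n → Set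
π ≈ₚ ρ = ∀ x → π ⟨$⟩ʳ x ≡ ρ ⟨$⟩ʳ x

_∈AutCh_ : ∀ {k n} → Permutation′ n → ColDigraph k (Fin n) → Set
φ ∈AutCh Γ = ∃ λ σ → IsChainAut Γ σ × (σ (+ 0) ≈ₚ φ)

conj : ∀ {n} → Permutation′ n → Permutation′ n → Permutation′ n
conj Ψ φ = flip Ψ ∘ₚ φ ∘ₚ Ψ

-- Let A be the adjacency matrix of one colour of Γ = DiCay(ℤ_m, S). A chain automorphism (σ_i)
-- preserves walk counts: A^k(σ_i v, σ_{i+k} w) = A^k(v, w). As A is the sum of the commuting
-- translation matrices T_s (s ∈ S) and T_s^p = T_{ps}, the Frobenius congruence gives
-- A^p ≡ Σ_{s∈S} T_{ps} (mod p) for a prime p, and when p is a unit modulo m the right-hand side is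
-- the 0/1 adjacency matrix of Γ^(p). Reading walk counts modulo p therefore shows that (σ_{ip})_i is
-- a chain automorphism of Γ^(p) with the same σ_0. Reversing the chain handles l = -1, and every
-- unit l is ± a product of prime units, so Aut^Ch(Γ) ⊆ Aut^Ch(Γ^(l)); applied to Γ^(l) and the
-- inverse of l this gives equality. Finally ψ_l is an isomorphism Γ → Γ^(l), so conjugation by ψ_l
-- maps Aut^Ch(Γ) onto Aut^Ch(Γ^(l)) = Aut^Ch(Γ).

{-# OPTIONS --safe #-}
module Submission where

open import Defs

open import Level using (0ℓ; _⊔_)
open import Function using (_∘_; id)
open import Function.Bundles using (Injection)
open import Function.Properties.Inverse using (↔⇒↣)
open import Data.Empty using (⊥-elim)
open import Data.Sum using (inj₁; inj₂; [_,_])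
open import Data.Product using (Σ; _×_; _,_; ∃; proj₁; proj₂; swap)
open import Data.List using ([]; _∷_)
open import Data.List.Relation.Unary.All using (All; []; _∷_)
open import Data.Nat as ℕ
  using (ℕ; NonZero; NonTrivial; zero; suc; _!; _∸_; nonTrivial⇒n>1; nonTrivial⇒nonZero)
import Data.Nat.Properties as ℕ
open import Data.Nat.DivMod using (_%_; m<n⇒m%n≡m; [m+kn]%n≡m%n; m/n*n≡m)
open import Data.Nat.Divisibility using (_∣_; divides; ∣1⇒≡1; ∣⇒≤; m∣m*n)
open import Data.Nat.GCD using (module Bézout)
open import Data.Nat.Coprimality using (Coprime; coprime-Bézout)
open import Data.Nat.Primality
  using (Prime; euclidsLemma; ¬prime[0]; ¬prime[1]; prime⇒nonZero; prime⇒nonTrivial)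
open import Data.Nat.Primality.Factorisation using (factorise; PrimeFactorisation)
open import Data.Nat.ListAction using (product)
open import Data.Nat.Combinatorics using (_C_; nCn≡1; k![n∸k]!∣n!)
open import Data.Nat.Combinatorics.Specification using (nCk≡n!/k![n-k]!)
open import Data.Integer as ℤ using (ℤ; ∣_∣; +_; -[1+_]; +[1+_]; 0ℤ; 1ℤ; -1ℤ)
import Data.Integer.Properties as ℤ
open import Data.Integer.DivMod using (_%ℕ_; _/ℕ_; n%ℕd<d; a≡a%ℕn+[a/ℕn]*n)
open import Data.Integer.Tactic.RingSolver using (solve-∀)
open import Data.Fin as Fin using (Fin; toℕ)
import Data.Fin.Properties as Fin
open import Data.Fin.Subset using (Subset)
open import Data.Fin.Subset.Properties using (_∈?_)
open import Data.Fin.Permutation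
  using (Permutation′; _⟨$⟩ʳ_; _⟨$⟩ˡ_; inverseʳ; inverseˡ; _∘ₚ_; flip; permutation)
open import Data.Vec.Functional using (removeAt; init; last)
open import Algebra.Bundles using (Semiring)
open import Algebra.Structures using (IsSemiring)
import Algebra.Construct.Pointwise as Pointwise
open import Algebra.Properties.Semiring.Sum ℕ.+-*-semiring
  using (sum; sum-cong-≗; sum-replicate-zero; sum-remove; sum-permute; ∑-comm; ∑-distrib-+;
         *-distribˡ-sum; *-distribʳ-sum)
open import Relation.Nullary using (¬_; Dec; yes; no)
open import Relation.Nullary.Decidable using (_×-dec_)
open import Relation.Unary as U using (Pred; _≐_)
open import Relation.Unary.Properties using (≐-trans)
open import Relation.Binary.Core using (Rel; _⇔_)
open import Relation.Binary.Definitions using (Decidable)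
open import Relation.Binary.Bundles using (Setoid)
import Relation.Binary.Reasoning.Setoid
open import Relation.Binary.PropositionalEquality
  using (_≡_; _≢_; refl; sym; trans; cong; cong₂; subst; subst₂; module ≡-Reasoning)

-- Congruences modulo an integer and arithmetic in ℤ_m

infix 4 _≡_[mod_]
record _≡_[mod_] (a b n : ℤ) : Set where
  constructor congruent
  field
    quotient : ℤ
    equation : a ≡ b ℤ.+ quotient ℤ.* n

module _ {n : ℤ} where

  open import Data.Integer using (_+_; _*_; -_; _-_)

  ≡-mod-refl : ∀ a → a ≡ a [mod n ]
  ≡-mod-refl a = congruent 0ℤ (sym (ℤ.+-identityʳ a))

  ≡-mod-reflexive : ∀ {a b} → a ≡ b → a ≡ b [mod n ]
  ≡-mod-reflexive refl = ≡-mod-refl _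

  -- No match on refl here, so that the quotient `- q` of the result also reduces on open terms.
  ≡-mod-sym : ∀ {a b} → a ≡ b [mod n ] → b ≡ a [mod n ]
  ≡-mod-sym {b = b} (congruent q a≡b+qn) =
    congruent (- q) (trans (b≡b+qn-qn b q n) (cong (_+ - q * n) (sym a≡b+qn)))
    where
    b≡b+qn-qn : ∀ b q n → b ≡ b + q * n + - q * n
    b≡b+qn-qn = solve-∀

  ≡-mod-trans : ∀ {a b c} → a ≡ b [mod n ] → b ≡ c [mod n ] → a ≡ c [mod n ]
  ≡-mod-trans {c = c} (congruent q refl) (congruent r refl) = congruent (r + q) (regroup c q r n)
    where
    regroup : ∀ c q r n → c + r * n + q * n ≡ c + (r + q) * n
    regroup = solve-∀

  ≡-mod-setoid : Setoid 0ℓ 0ℓ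
  ≡-mod-setoid = record
    { _≈_ = _≡_[mod n ]
    ; isEquivalence = record
      { refl = ≡-mod-refl _ ; sym = ≡-mod-sym ; trans = ≡-mod-trans } }

  +-cong-≡-mod : ∀ {a a′ b b′} → a ≡ a′ [mod n ] → b ≡ b′ [mod n ] → a + b ≡ a′ + b′ [mod n ]
  +-cong-≡-mod {a′ = a′} {b′ = b′} (congruent q refl) (congruent r refl) =
    congruent (q + r) (regroup a′ b′ q r n)
    where
    regroup : ∀ a b q r n → a + q * n + (b + r * n) ≡ a + b + (q + r) * n
    regroup = solve-∀

  *-cong-≡-mod : ∀ {a a′ b b′} → a ≡ a′ [mod n ] → b ≡ b′ [mod n ] → a * b ≡ a′ * b′ [mod n ]
  *-cong-≡-mod {a′ = a′} {b′ = b′} (congruent q refl) (congruent r refl) =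
    congruent (q * b′ + a′ * r + q * r * n) (expand a′ b′ q r n)
    where
    expand : ∀ a b q r n → (a + q * n) * (b + r * n) ≡ a * b + (q * b + a * r + q * r * n) * n
    expand = solve-∀

  minus-cong-≡-mod : ∀ {a a′ b b′} → a ≡ a′ [mod n ] → b ≡ b′ [mod n ] → a - b ≡ a′ - b′ [mod n ]
  minus-cong-≡-mod {a′ = a′} {b′ = b′} (congruent q refl) (congruent r refl) =
    congruent (q - r) (regroup a′ b′ q r n)
    where
    regroup : ∀ a b q r n → a + q * n - (b + r * n) ≡ a - b + (q - r) * n
    regroup = solve-∀

module _ {m : ℕ} .{{_ : NonZero m}} where

  open import Data.Integer using (_+_; _*_; -_; _-_)

  module ≡ₘ-Reasoning = Relation.Binary.Reasoning.Setoid (≡-mod-setoid {+ m})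

  toℤ : Fin m → ℤ
  toℤ x = + toℕ x

  private
    pos-+-* : ∀ a b c → + (a ℕ.+ b ℕ.* c) ≡ + a + + b * + c
    pos-+-* a b c = trans (ℤ.pos-+ a _) (cong (_+_ (+ a)) (ℤ.pos-* b c))

    no-large-multiple : ∀ {r s} q → r ℕ.< m → + r ≢ + s + + suc q * + m
    no-large-multiple {r} {s} q r<m r≡s+qm = ℕ.<⇒≱ r<m (begin
      m                  ≤⟨ ℕ.m≤n*m m (suc q) ⟩
      suc q ℕ.* m        ≤⟨ ℕ.m≤n+m _ s ⟩
      s ℕ.+ suc q ℕ.* m  ≡⟨ ℤ.+-injective (trans r≡s+qm (sym (pos-+-* s (suc q) m))) ⟨
      r                  ∎)
      where open ℕ.≤-Reasoning

  remainder-unique : ∀ {r s} → r ℕ.< m → s ℕ.< m → + r ≡ + s [mod + m ] → r ≡ s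
  remainder-unique _ _ (congruent (+ 0) r≡s) = trans (ℤ.+-injective r≡s) (ℕ.+-identityʳ _)
  remainder-unique r<m _ (congruent +[1+ q ] r≡s+qm) = ⊥-elim (no-large-multiple q r<m r≡s+qm)
  remainder-unique _ s<m r≡s@(congruent -[1+ q ] _) =
    ⊥-elim (no-large-multiple q s<m (_≡_[mod_].equation (≡-mod-sym r≡s)))

  toℤ-injective-mod : ∀ {x y} → toℤ x ≡ toℤ y [mod + m ] → x ≡ y
  toℤ-injective-mod {x} {y} = Fin.toℕ-injective ∘ remainder-unique (Fin.toℕ<n x) (Fin.toℕ<n y)

  toℤ-[]ₘ : ∀ a → toℤ [ a ]ₘ ≡ a [mod + m ]
  toℤ-[]ₘ a = subst (λ r → + r ≡ a [mod + m ]) (sym toℕ-[a]ₘ≡a%m)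
    (≡-mod-sym (congruent (a /ℕ m) (a≡a%ℕn+[a/ℕn]*n a m)))
    where
    toℕ-[a]ₘ≡a%m : toℕ [ a ]ₘ ≡ a %ℕ m
    toℕ-[a]ₘ≡a%m = trans (Fin.toℕ-fromℕ< _) (m<n⇒m%n≡m (n%ℕd<d a m))

  toℤ-+ₘ : ∀ x y → toℤ (x +ₘ y) ≡ toℤ x + toℤ y [mod + m ]
  toℤ-+ₘ x y = toℤ-[]ₘ (toℤ x + toℤ y)

  toℤ--ₘ : ∀ x y → toℤ (x -ₘ y) ≡ toℤ x - toℤ y [mod + m ]
  toℤ--ₘ x y = toℤ-[]ₘ (toℤ x - toℤ y)

  toℤ-ψ : ∀ l x → toℤ (ψ l x) ≡ l * toℤ x [mod + m ]
  toℤ-ψ l x = toℤ-[]ₘ (l * toℤ x)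

  toℤ-0ₘ : toℤ 0ₘ ≡ 0ℤ [mod + m ]
  toℤ-0ₘ = toℤ-[]ₘ 0ℤ

  +ₘ-comm : ∀ x y → x +ₘ y ≡ y +ₘ x
  +ₘ-comm x y = toℤ-injective-mod (begin
    toℤ (x +ₘ y)   ≈⟨ toℤ-+ₘ x y ⟩
    toℤ x + toℤ y  ≡⟨ ℤ.+-comm (toℤ x) (toℤ y) ⟩
    toℤ y + toℤ x  ≈⟨ toℤ-+ₘ y x ⟨
    toℤ (y +ₘ x)   ∎)
    where open ≡ₘ-Reasoning

  +ₘ-assoc : ∀ x y z → (x +ₘ y) +ₘ z ≡ x +ₘ (y +ₘ z)
  +ₘ-assoc x y z = toℤ-injective-mod (begin
    toℤ ((x +ₘ y) +ₘ z)        ≈⟨ toℤ-+ₘ (x +ₘ y) z ⟩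
    toℤ (x +ₘ y) + toℤ z       ≈⟨ +-cong-≡-mod (toℤ-+ₘ x y) (≡-mod-refl (toℤ z)) ⟩
    toℤ x + toℤ y + toℤ z      ≡⟨ ℤ.+-assoc (toℤ x) (toℤ y) (toℤ z) ⟩
    toℤ x + (toℤ y + toℤ z)    ≈⟨ +-cong-≡-mod (≡-mod-refl (toℤ x)) (toℤ-+ₘ y z) ⟨
    toℤ x + toℤ (y +ₘ z)       ≈⟨ toℤ-+ₘ x (y +ₘ z) ⟨
    toℤ (x +ₘ (y +ₘ z))        ∎)
    where open ≡ₘ-Reasoning

  +ₘ-identityʳ : ∀ x → x +ₘ 0ₘ ≡ x
  +ₘ-identityʳ x = toℤ-injective-mod (begin
    toℤ (x +ₘ 0ₘ)     ≈⟨ toℤ-+ₘ x 0ₘ ⟩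
    toℤ x + toℤ 0ₘ    ≈⟨ +-cong-≡-mod (≡-mod-refl (toℤ x)) toℤ-0ₘ ⟩
    toℤ x + 0ℤ        ≡⟨ ℤ.+-identityʳ (toℤ x) ⟩
    toℤ x             ∎)
    where open ≡ₘ-Reasoning

  [x+s]-x≡s : ∀ x s → (x +ₘ s) -ₘ x ≡ s
  [x+s]-x≡s x s = toℤ-injective-mod (begin
    toℤ ((x +ₘ s) -ₘ x)    ≈⟨ toℤ--ₘ (x +ₘ s) x ⟩
    toℤ (x +ₘ s) - toℤ x   ≈⟨ minus-cong-≡-mod (toℤ-+ₘ x s) (≡-mod-refl (toℤ x)) ⟩
    toℤ x + toℤ s - toℤ x  ≡⟨ a+b-a≡b (toℤ x) (toℤ s) ⟩
    toℤ s                  ∎)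
    where
    open ≡ₘ-Reasoning
    a+b-a≡b : ∀ a b → a + b - a ≡ b
    a+b-a≡b = solve-∀

  x+[y-x]≡y : ∀ x y → x +ₘ (y -ₘ x) ≡ y
  x+[y-x]≡y x y = toℤ-injective-mod (begin
    toℤ (x +ₘ (y -ₘ x))      ≈⟨ toℤ-+ₘ x (y -ₘ x) ⟩
    toℤ x + toℤ (y -ₘ x)     ≈⟨ +-cong-≡-mod (≡-mod-refl (toℤ x)) (toℤ--ₘ y x) ⟩
    toℤ x + (toℤ y - toℤ x)  ≡⟨ a+[b-a]≡b (toℤ x) (toℤ y) ⟩
    toℤ y                    ∎)
    where
    open ≡ₘ-Reasoning
    a+[b-a]≡b : ∀ a b → a + (b - a) ≡ b
    a+[b-a]≡b = solve-∀

  ψ-cong : ∀ {a b} → a ≡ b [mod + m ] → ∀ s → ψ a s ≡ ψ b s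
  ψ-cong {a} {b} a≡b s = toℤ-injective-mod (begin
    toℤ (ψ a s)  ≈⟨ toℤ-ψ a s ⟩
    a * toℤ s    ≈⟨ *-cong-≡-mod a≡b (≡-mod-refl (toℤ s)) ⟩
    b * toℤ s    ≈⟨ toℤ-ψ b s ⟨
    toℤ (ψ b s)  ∎)
    where open ≡ₘ-Reasoning

  ψ-∘ : ∀ a b s → ψ a (ψ b s) ≡ ψ (a * b) s
  ψ-∘ a b s = toℤ-injective-mod (begin
    toℤ (ψ a (ψ b s))  ≈⟨ toℤ-ψ a (ψ b s) ⟩
    a * toℤ (ψ b s)    ≈⟨ *-cong-≡-mod (≡-mod-refl a) (toℤ-ψ b s) ⟩
    a * (b * toℤ s)    ≡⟨ ℤ.*-assoc a b (toℤ s) ⟨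
    a * b * toℤ s      ≈⟨ toℤ-ψ (a * b) s ⟨
    toℤ (ψ (a * b) s)  ∎)
    where open ≡ₘ-Reasoning

  ψ-identity : ∀ s → ψ 1ℤ s ≡ s
  ψ-identity s = toℤ-injective-mod (begin
    toℤ (ψ 1ℤ s)  ≈⟨ toℤ-ψ 1ℤ s ⟩
    1ℤ * toℤ s    ≡⟨ ℤ.*-identityˡ (toℤ s) ⟩
    toℤ s         ∎)
    where open ≡ₘ-Reasoning

  ψ-zero : ∀ s → ψ 0ℤ s ≡ 0ₘ
  ψ-zero s = toℤ-injective-mod (begin
    toℤ (ψ 0ℤ s)  ≈⟨ toℤ-ψ 0ℤ s ⟩
    0ℤ * toℤ s    ≡⟨ ℤ.*-zeroˡ (toℤ s) ⟩
    0ℤ            ≈⟨ toℤ-0ₘ ⟨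
    toℤ 0ₘ        ∎)
    where open ≡ₘ-Reasoning

  ψ-1+ : ∀ l s → ψ (1ℤ + l) s ≡ s +ₘ ψ l s
  ψ-1+ l s = toℤ-injective-mod (begin
    toℤ (ψ (1ℤ + l) s)     ≈⟨ toℤ-ψ (1ℤ + l) s ⟩
    (1ℤ + l) * toℤ s       ≡⟨ [1+a]*b≡b+a*b l (toℤ s) ⟩
    toℤ s + l * toℤ s      ≈⟨ +-cong-≡-mod (≡-mod-refl (toℤ s)) (toℤ-ψ l s) ⟨
    toℤ s + toℤ (ψ l s)    ≈⟨ toℤ-+ₘ s (ψ l s) ⟨
    toℤ (s +ₘ ψ l s)       ∎)
    where
    open ≡ₘ-Reasoning
    [1+a]*b≡b+a*b : ∀ a b → (1ℤ + a) * b ≡ b + a * b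
    [1+a]*b≡b+a*b = solve-∀

  ψ-distrib--ₘ : ∀ l x y → ψ l (y -ₘ x) ≡ ψ l y -ₘ ψ l x
  ψ-distrib--ₘ l x y = toℤ-injective-mod (begin
    toℤ (ψ l (y -ₘ x))              ≈⟨ toℤ-ψ l (y -ₘ x) ⟩
    l * toℤ (y -ₘ x)                ≈⟨ *-cong-≡-mod (≡-mod-refl l) (toℤ--ₘ y x) ⟩
    l * (toℤ y - toℤ x)             ≡⟨ a*[b-c]≡a*b-a*c l (toℤ y) (toℤ x) ⟩
    l * toℤ y - l * toℤ x           ≈⟨ minus-cong-≡-mod (toℤ-ψ l y) (toℤ-ψ l x) ⟨
    toℤ (ψ l y) - toℤ (ψ l x)       ≈⟨ toℤ--ₘ (ψ l y) (ψ l x) ⟨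
    toℤ (ψ l y -ₘ ψ l x)            ∎)
    where
    open ≡ₘ-Reasoning
    a*[b-c]≡a*b-a*c : ∀ a b c → a * (b - c) ≡ a * b - a * c
    a*[b-c]≡a*b-a*c = solve-∀

  ψ-neg : ∀ x y → ψ -1ℤ (y -ₘ x) ≡ x -ₘ y
  ψ-neg x y = toℤ-injective-mod (begin
    toℤ (ψ -1ℤ (y -ₘ x))      ≈⟨ toℤ-ψ -1ℤ (y -ₘ x) ⟩
    -1ℤ * toℤ (y -ₘ x)        ≈⟨ *-cong-≡-mod (≡-mod-refl -1ℤ) (toℤ--ₘ y x) ⟩
    -1ℤ * (toℤ y - toℤ x)     ≡⟨ -[b-a]≡a-b (toℤ x) (toℤ y) ⟩
    toℤ x - toℤ y             ≈⟨ toℤ--ₘ x y ⟨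
    toℤ (x -ₘ y)              ∎)
    where
    open ≡ₘ-Reasoning
    -[b-a]≡a-b : ∀ a b → -1ℤ * (b - a) ≡ a - b
    -[b-a]≡a-b = solve-∀

  record Invertible (l : ℤ) : Set where
    constructor invertible
    field
      inverse  : ℤ
      inverse-cancelˡ : inverse * l ≡ 1ℤ [mod + m ]

  ψ-inverseˡ : ∀ {l} (u : Invertible l) s → ψ (Invertible.inverse u) (ψ l s) ≡ s
  ψ-inverseˡ {l} (invertible l′ l′l≡1) s = trans (ψ-∘ l′ l s) (trans (ψ-cong l′l≡1 s) (ψ-identity s))

  ψ-injective : ∀ {l} → Invertible l → ∀ {s t} → ψ l s ≡ ψ l t → s ≡ t
  ψ-injective {l} u@(invertible l′ _) {s} {t} ψs≡ψt = begin
    s               ≡⟨ ψ-inverseˡ u s ⟨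
    ψ l′ (ψ l s)    ≡⟨ cong (ψ l′) ψs≡ψt ⟩
    ψ l′ (ψ l t)    ≡⟨ ψ-inverseˡ u t ⟩
    t               ∎
    where open ≡-Reasoning

  invertible-neg : ∀ {a} → Invertible a → Invertible (- a)
  invertible-neg {a} (invertible u ua≡1) =
    invertible (- u) (subst (_≡ 1ℤ [mod + m ]) (a*b≡-a*-b u a) ua≡1)
    where
    a*b≡-a*-b : ∀ a b → a * b ≡ - a * - b
    a*b≡-a*-b = solve-∀

  coprime⇒invertible : ∀ l → Coprime ∣ l ∣ m → Invertible l
  coprime⇒invertible (+ n) n⊥m with coprime-Bézout n⊥m
  ... | Bézout.+- x y 1+ym≡xn = invertible (+ x) (congruent (+ y) (begin
    + x * + n        ≡⟨ ℤ.pos-* x n ⟨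
    + (x ℕ.* n)      ≡⟨ cong +_ 1+ym≡xn ⟨
    + (1 ℕ.+ y ℕ.* m) ≡⟨ pos-+-* 1 y m ⟩
    1ℤ + + y * + m   ∎))
    where open ≡-Reasoning
  ... | Bézout.-+ x y 1+xn≡ym = invertible (- + x) (congruent (- + y) (begin
    - + x * + n              ≡⟨ -a*b≡1-[1+a*b] (+ x) (+ n) ⟩
    1ℤ - (1ℤ + + x * + n)    ≡⟨ cong (_-_ 1ℤ) 1+xn≡ym-in-ℤ ⟩
    1ℤ - + y * + m           ≡⟨ cong (_+_ 1ℤ) (ℤ.neg-distribˡ-* (+ y) (+ m)) ⟩
    1ℤ + - + y * + m         ∎))
    where
    open ≡-Reasoning
    1+xn≡ym-in-ℤ : 1ℤ + + x * + n ≡ + y * + m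
    1+xn≡ym-in-ℤ = trans (sym (pos-+-* 1 x n)) (trans (cong +_ 1+xn≡ym) (ℤ.pos-* y m))
    -a*b≡1-[1+a*b] : ∀ a b → - a * b ≡ 1ℤ - (1ℤ + a * b)
    -a*b≡1-[1+a*b] = solve-∀
  coprime⇒invertible -[1+ n ] n⊥m = invertible-neg (coprime⇒invertible (+ suc n) n⊥m)

  invertible-*ˡ : ∀ a b → Invertible (a * b) → Invertible a
  invertible-*ˡ a b (invertible u u[ab]≡1) =
    invertible (u * b) (subst (_≡ 1ℤ [mod + m ]) (reassoc u a b) u[ab]≡1)
    where
    reassoc : ∀ u a b → u * (a * b) ≡ u * b * a
    reassoc = solve-∀

  invertible-*ʳ : ∀ a b → Invertible (a * b) → Invertible b
  invertible-*ʳ a b (invertible u u[ab]≡1) =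
    invertible (u * a) (subst (_≡ 1ℤ [mod + m ]) (sym (ℤ.*-assoc u a b)) u[ab]≡1)

  inverse-invertible : ∀ {l} (u : Invertible l) → Invertible (Invertible.inverse u)
  inverse-invertible {l} (invertible l′ l′l≡1) =
    invertible l (subst (_≡ 1ℤ [mod + m ]) (ℤ.*-comm l′ l) l′l≡1)

-- Chain automorphisms and isomorphisms

module _ {k n : ℕ} where

  open import Data.Integer using (_+_; -_)

  ∈AutCh-resp-⇔ : ∀ (Γ Γ′ : ColDigraph k (Fin n)) → (∀ j → E Γ j ⇔ E Γ′ j) →
                  ∀ φ → φ ∈AutCh Γ → φ ∈AutCh Γ′
  ∈AutCh-resp-⇔ _ _ Γ⇔Γ′ _ (σ , σ-aut , σ₀≈φ) = σ , σ-aut′ , σ₀≈φ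
    where
    σ-aut′ : IsChainAut _ σ
    σ-aut′ i j v w = let to , from = Γ⇔Γ′ j ; fwd , bwd = σ-aut i j v w in
      to ∘ fwd ∘ from , to ∘ bwd ∘ from

  IsIsomorphism : ColDigraph k (Fin n) → ColDigraph k (Fin n) → Permutation′ n → Set
  IsIsomorphism Γ Γ′ Ψ = ∀ j v w →
    (E Γ j v w → E Γ′ j (Ψ ⟨$⟩ʳ v) (Ψ ⟨$⟩ʳ w)) ×
    (E Γ′ j (Ψ ⟨$⟩ʳ v) (Ψ ⟨$⟩ʳ w) → E Γ j v w)

  isomorphism-flip : ∀ Γ Γ′ Ψ → IsIsomorphism Γ Γ′ Ψ → IsIsomorphism Γ′ Γ (flip Ψ)
  isomorphism-flip Γ Γ′ Ψ Ψ-iso j v w =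
    proj₂ (Ψ-iso j _ _) ∘ subst₂ (E Γ′ j) (sym (inverseʳ Ψ)) (sym (inverseʳ Ψ)) ,
    subst₂ (E Γ′ j) (inverseʳ Ψ) (inverseʳ Ψ) ∘ proj₁ (Ψ-iso j _ _)

  conj-∈AutCh : ∀ Γ Γ′ Ψ → IsIsomorphism Γ Γ′ Ψ → ∀ φ → φ ∈AutCh Γ → conj Ψ φ ∈AutCh Γ′
  conj-∈AutCh Γ Γ′ Ψ Ψ-iso _ (σ , σ-aut , σ₀≈φ) =
    (λ i → conj Ψ (σ i)) , σ-aut′ , λ x → cong (Ψ ⟨$⟩ʳ_) (σ₀≈φ (Ψ ⟨$⟩ˡ x))
    where
    σ-aut′ : IsChainAut Γ′ (λ i → conj Ψ (σ i))
    σ-aut′ i j v w =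
      let in₁ , out₁ = isomorphism-flip Γ Γ′ Ψ Ψ-iso j v w
          in₂ , out₂ = σ-aut i j (Ψ ⟨$⟩ˡ v) (Ψ ⟨$⟩ˡ w)
          in₃ , out₃ = Ψ-iso j (σ i ⟨$⟩ʳ (Ψ ⟨$⟩ˡ v)) (σ (i + 1ℤ) ⟨$⟩ʳ (Ψ ⟨$⟩ˡ w))
      in in₃ ∘ in₂ ∘ in₁ , out₁ ∘ out₂ ∘ out₃

  reverse : ColDigraph k (Fin n) → ColDigraph k (Fin n)
  E (reverse Γ) j v w = E Γ j w v

  ∈AutCh-reverse : ∀ Γ φ → φ ∈AutCh Γ → φ ∈AutCh reverse Γ
  ∈AutCh-reverse Γ _ (σ , σ-aut , σ₀≈φ) = (λ i → σ (- i)) , σ-aut′ , σ₀≈φ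
    where
    -[i+1]+1≡-i : ∀ i → - (i + 1ℤ) + 1ℤ ≡ - i
    -[i+1]+1≡-i = solve-∀
    σ-aut′ : IsChainAut (reverse Γ) (λ i → σ (- i))
    σ-aut′ i j v w =
      let fwd , bwd = σ-aut (- (i + 1ℤ)) j w v
          edge-to = λ t → E Γ j (σ (- (i + 1ℤ)) ⟨$⟩ʳ w) (σ t ⟨$⟩ʳ v)
      in subst edge-to (-[i+1]+1≡-i i) ∘ fwd , bwd ∘ subst edge-to (sym (-[i+1]+1≡-i i))

module _ {n : ℕ} (Ψ : Permutation′ n) where

  conj-flip : ∀ φ → conj Ψ (conj (flip Ψ) φ) ≈ₚ φ
  conj-flip φ x = trans (inverseʳ Ψ) (cong (φ ⟨$⟩ʳ_) (inverseʳ Ψ))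

  conj-injective : ∀ φ φ′ → conj Ψ φ ≈ₚ conj Ψ φ′ → φ ≈ₚ φ′
  conj-injective φ φ′ Ψφ≈Ψφ′ x = begin
    φ ⟨$⟩ʳ x                            ≡⟨ cong (φ ⟨$⟩ʳ_) (inverseˡ Ψ) ⟨
    φ ⟨$⟩ʳ (Ψ ⟨$⟩ˡ (Ψ ⟨$⟩ʳ x))          ≡⟨ inverseˡ Ψ ⟨
    Ψ ⟨$⟩ˡ (conj Ψ φ ⟨$⟩ʳ (Ψ ⟨$⟩ʳ x))   ≡⟨ cong (Ψ ⟨$⟩ˡ_) (Ψφ≈Ψφ′ (Ψ ⟨$⟩ʳ x)) ⟩
    Ψ ⟨$⟩ˡ (conj Ψ φ′ ⟨$⟩ʳ (Ψ ⟨$⟩ʳ x))  ≡⟨ inverseˡ Ψ ⟩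
    φ′ ⟨$⟩ʳ (Ψ ⟨$⟩ˡ (Ψ ⟨$⟩ʳ x))         ≡⟨ cong (φ′ ⟨$⟩ʳ_) (inverseˡ Ψ) ⟩
    φ′ ⟨$⟩ʳ x                           ∎
    where open ≡-Reasoning

  conj-∘ₚ : ∀ φ φ′ → conj Ψ (φ ∘ₚ φ′) ≈ₚ (conj Ψ φ ∘ₚ conj Ψ φ′)
  conj-∘ₚ φ φ′ x = cong (λ y → Ψ ⟨$⟩ʳ (φ′ ⟨$⟩ʳ y)) (sym (inverseˡ Ψ))

-- The Frobenius congruence

prime∤k! : ∀ {p k} → Prime p → k ℕ.< p → ¬ (p ∣ k !)
prime∤k! {k = zero}  p-prime _   p∣1 = ¬prime[1] (subst Prime (∣1⇒≡1 p∣1) p-prime)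
prime∤k! {k = suc k} p-prime k<p p∣k! with euclidsLemma (suc k) (k !) p-prime p∣k!
... | inj₁ p∣1+k = ℕ.<⇒≱ k<p (∣⇒≤ p∣1+k)
... | inj₂ p∣k!  = prime∤k! p-prime (ℕ.<-trans (ℕ.n<1+n k) k<p) p∣k!

prime∣pCk : ∀ {p k} → Prime p → 0 ℕ.< k → k ℕ.< p → p ∣ p C k
prime∣pCk {p@(suc q)} {k} p-prime 0<k k<p
  with euclidsLemma (p C k) (k ! ℕ.* (p ∸ k) !) p-prime (subst (p ∣_) (sym pCk*k![p∸k]!≡p!) (m∣m*n (q !)))
  where
  k≤p = ℕ.<⇒≤ k<p
  instance _ = k ℕ.!* (p ∸ k) !≢0
  pCk*k![p∸k]!≡p! : (p C k) ℕ.* (k ! ℕ.* (p ∸ k) !) ≡ p !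
  pCk*k![p∸k]!≡p! = trans (cong (ℕ._* (k ! ℕ.* (p ∸ k) !)) (nCk≡n!/k![n-k]! k≤p)) (m/n*n≡m (k![n∸k]!∣n! k≤p))
... | inj₁ p∣pCk = p∣pCk
... | inj₂ p∣k![p∸k]! = ⊥-elim
  ([ prime∤k! p-prime k<p , prime∤k! p-prime (ℕ.∸-monoʳ-< 0<k (ℕ.<⇒≤ k<p)) ]
   (euclidsLemma (k !) ((p ∸ k) !) p-prime p∣k![p∸k]!))

module Frobenius {a ℓ} (R : Semiring a ℓ) where

  open Semiring R renaming (refl to ≈-refl; sym to ≈-sym; trans to ≈-trans)
  open import Algebra.Properties.Semiring.Exp R using (_^_)
  open import Algebra.Properties.Semiring.Mult R using (×-homo-1; ×-assocˡ) renaming (_×_ to _·_)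
  open import Algebra.Properties.CommutativeMonoid.Mult +-commutativeMonoid using (×-distrib-+)
  open import Algebra.Properties.Semiring.Sum R
    using () renaming (sum to ∑; sum-init-last to ∑-init-last; sum-cong-≋ to ∑-cong-≋;
                       *-distribˡ-sum to *-distribˡ-∑; *-distribʳ-sum to *-distribʳ-∑)
  import Algebra.Properties.Semiring.Binomial R as Binomial
  open import Relation.Binary.Reasoning.Setoid setoid

  record Multiple (p : ℕ) (x : Carrier) : Set (a ⊔ ℓ) where
    constructor multiple
    field
      cofactor : Carrier
      ≈p·cofactor : x ≈ p · cofactor

  ·-zeroʳ : ∀ n → n · 0# ≈ 0#
  ·-zeroʳ zero    = ≈-refl
  ·-zeroʳ (suc n) = ≈-trans (+-congˡ (·-zeroʳ n)) (+-identityʳ 0#)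

  multiple-+ : ∀ {p x y} → Multiple p x → Multiple p y → Multiple p (x + y)
  multiple-+ {p} (multiple z₁ x≈pz₁) (multiple z₂ y≈pz₂) =
    multiple (z₁ + z₂) (≈-trans (+-cong x≈pz₁ y≈pz₂) (≈-sym (×-distrib-+ z₁ z₂ p)))

  multiple-∑ : ∀ {p k} (f : Fin k → Carrier) → (∀ i → Multiple p (f i)) → Multiple p (∑ f)
  multiple-∑ {p} {zero}  f _      = multiple 0# (≈-sym (·-zeroʳ p))
  multiple-∑ {p} {suc k} f mult-f =
    multiple-+ (mult-f Fin.zero) (multiple-∑ (f ∘ Fin.suc) (mult-f ∘ Fin.suc))

  multiple-· : ∀ {p c} → p ∣ c → ∀ x → Multiple p (c · x)
  multiple-· {p} {c} (divides q c≡qp) x = multiple (q · x) (begin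
    c · x           ≡⟨ cong (_· x) (trans c≡qp (ℕ.*-comm q p)) ⟩
    (p ℕ.* q) · x   ≈⟨ ×-assocˡ x p q ⟨
    p · (q · x)     ∎)

  frobenius : ∀ {p} → Prime p → ∀ {x y} → x * y ≈ y * x → ∃ λ z → (x + y) ^ p ≈ x ^ p + y ^ p + p · z
  frobenius {zero} 0-prime = ⊥-elim (¬prime[0] 0-prime)
  frobenius {p@(suc q)} p-prime {x} {y} xy≈yx = z , (begin
    (x + y) ^ p                                     ≈⟨ theorem xy≈yx p ⟩
    binomialTerm p Fin.zero + ∑ upper               ≈⟨ +-cong first≈yᵖ (∑-init-last upper) ⟩
    y ^ p + (∑ (init upper) + last upper)           ≈⟨ +-congˡ (+-cong middle≈pz last≈xᵖ) ⟩
    y ^ p + (p · z + x ^ p)                         ≈⟨ +-congˡ (+-comm _ _) ⟩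
    y ^ p + (x ^ p + p · z)                         ≈⟨ +-assoc _ _ _ ⟨
    y ^ p + x ^ p + p · z                           ≈⟨ +-congʳ (+-comm _ _) ⟩
    x ^ p + y ^ p + p · z                           ∎)
    where
    open Binomial x y using (binomialTerm; theorem)

    binomialTerm-at : ∀ (k : Fin (suc p)) {j} → toℕ k ≡ j → binomialTerm p k ≈ (p C j) · (x ^ j * y ^ (p ∸ j))
    binomialTerm-at k refl = ≈-refl

    upper : Fin p → Carrier
    upper k = binomialTerm p (Fin.suc k)

    first≈yᵖ : binomialTerm p Fin.zero ≈ y ^ p
    first≈yᵖ = ≈-trans (×-homo-1 _) (*-identityˡ _)

    last≈xᵖ : last upper ≈ x ^ p
    last≈xᵖ = begin
      last upper                       ≈⟨ binomialTerm-at (Fin.suc (Fin.fromℕ q)) (cong suc (Fin.toℕ-fromℕ q)) ⟩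
      (p C p) · (x ^ p * y ^ (p ∸ p))  ≡⟨ cong₂ (λ c e → c · (x ^ p * y ^ e)) (nCn≡1 p) (ℕ.n∸n≡0 p) ⟩
      1 · (x ^ p * 1#)                 ≈⟨ ×-homo-1 _ ⟩
      x ^ p * 1#                       ≈⟨ *-identityʳ _ ⟩
      x ^ p                            ∎

    p∣middle : ∀ k → Multiple p (init upper k)
    p∣middle k =
      let multiple w e = multiple-· (prime∣pCk p-prime (ℕ.s≤s ℕ.z≤n) (ℕ.s≤s (Fin.toℕ<n k))) _
      in multiple w (≈-trans (binomialTerm-at (Fin.suc (Fin.inject₁ k)) (cong suc (Fin.toℕ-inject₁ k))) e)

    open Multiple (multiple-∑ (init upper) p∣middle) renaming (cofactor to z; ≈p·cofactor to middle≈pz)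

  frobenius-∑ : ∀ {p} → Prime p → ∀ {k} (f : Fin k → Carrier) → (∀ i j → f i * f j ≈ f j * f i) →
                ∃ λ z → ∑ f ^ p ≈ ∑ (λ i → f i ^ p) + p · z
  frobenius-∑ {zero} 0-prime = ⊥-elim (¬prime[0] 0-prime)
  frobenius-∑ {p@(suc q)} p-prime {zero} f _ = 0# , (begin
    0# * 0# ^ q      ≈⟨ zeroˡ _ ⟩
    0#               ≈⟨ +-identityʳ 0# ⟨
    0# + 0#          ≈⟨ +-congˡ (·-zeroʳ p) ⟨
    0# + p · 0#      ∎)
  frobenius-∑ {p} p-prime {suc k} f f-comm = z₂ + z₁ , (begin
    (x + ∑ g) ^ p                              ≈⟨ x+∑g≈ ⟩
    x ^ p + ∑ g ^ p + p · z₁                   ≈⟨ +-congʳ (+-congˡ ∑g≈) ⟩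
    x ^ p + (∑ gᵖ + p · z₂) + p · z₁           ≈⟨ +-congʳ (+-assoc _ _ _) ⟨
    x ^ p + ∑ gᵖ + p · z₂ + p · z₁             ≈⟨ +-assoc _ _ _ ⟩
    x ^ p + ∑ gᵖ + (p · z₂ + p · z₁)           ≈⟨ +-congˡ (×-distrib-+ z₂ z₁ p) ⟨
    x ^ p + ∑ gᵖ + p · (z₂ + z₁)               ∎)
    where
    x = f Fin.zero
    g = f ∘ Fin.suc
    gᵖ = λ i → g i ^ p
    x∑g≈∑gx : x * ∑ g ≈ ∑ g * x
    x∑g≈∑gx = begin
      x * ∑ g              ≈⟨ *-distribˡ-∑ x g ⟩
      ∑ (λ i → x * g i)    ≈⟨ ∑-cong-≋ (λ i → f-comm Fin.zero (Fin.suc i)) ⟩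
      ∑ (λ i → g i * x)    ≈⟨ *-distribʳ-∑ x g ⟨
      ∑ g * x              ∎
    open Σ (frobenius p-prime x∑g≈∑gx) renaming (proj₁ to z₁; proj₂ to x+∑g≈)
    open Σ (frobenius-∑ p-prime g λ i j → f-comm (Fin.suc i) (Fin.suc j)) renaming (proj₁ to z₂; proj₂ to ∑g≈)

-- Matrices over ℕ and walk counts

indicator : ∀ {P : Set} → Dec P → ℕ
indicator (yes _) = 1
indicator (no _)  = 0

module _ {P Q : Set} where

  indicator-cong : (P? : Dec P) (Q? : Dec Q) → (P → Q) → (Q → P) → indicator P? ≡ indicator Q?
  indicator-cong (yes _) (yes _) _   _   = refl
  indicator-cong (no _)  (no _)  _   _   = refl
  indicator-cong (yes p) (no ¬q) P→Q _   = ⊥-elim (¬q (P→Q p))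
  indicator-cong (no ¬p) (yes q) _   Q→P = ⊥-elim (¬p (Q→P q))

  indicator-≡⇒ : (P? : Dec P) (Q? : Dec Q) → indicator P? ≡ indicator Q? → P → Q
  indicator-≡⇒ _      (yes q) _ _ = q
  indicator-≡⇒ (no ¬p) (no _) _ p = ⊥-elim (¬p p)

indicator-yes : ∀ {P : Set} (P? : Dec P) → P → indicator P? ≡ 1
indicator-yes (yes _) _  = refl
indicator-yes (no ¬p) p  = ⊥-elim (¬p p)

indicator-no : ∀ {P : Set} (P? : Dec P) → ¬ P → indicator P? ≡ 0
indicator-no (yes p) ¬p = ⊥-elim (¬p p)
indicator-no (no _)  _  = refl

indicator<2 : ∀ {P : Set} (P? : Dec P) → indicator P? ℕ.< 2
indicator<2 (yes _) = ℕ.s≤s (ℕ.s≤s ℕ.z≤n)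
indicator<2 (no _)  = ℕ.s≤s ℕ.z≤n

sum-zero : ∀ {n} (f : Fin n → ℕ) → (∀ k → f k ≡ 0) → sum f ≡ 0
sum-zero {n} f f≡0 = trans (sum-cong-≗ f≡0) (sum-replicate-zero n)

sum-single : ∀ {n} (f : Fin n → ℕ) i → (∀ k → k ≢ i → f k ≡ 0) → sum f ≡ f i
sum-single {suc _} f i f≡0 = begin
  sum f                          ≡⟨ sum-remove f ⟩
  f i ℕ.+ sum (removeAt f i)
    ≡⟨ cong (f i ℕ.+_) (sum-zero (removeAt f i) λ k → f≡0 _ (Fin.punchInᵢ≢i i k)) ⟩
  f i ℕ.+ 0                      ≡⟨ ℕ.+-identityʳ (f i) ⟩
  f i                            ∎
  where open ≡-Reasoning

sum-indicator : ∀ {n} {P : Pred (Fin n) 0ℓ} (P? : U.Decidable P) → (∀ {s t} → P s → P t → s ≡ t) →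
                sum (λ s → indicator (P? s)) ≡ indicator (Fin.any? P?)
sum-indicator P? P-unique with Fin.any? P?
... | yes (s₀ , Ps₀) = trans
  (sum-single _ s₀ λ s s≢s₀ → indicator-no (P? s) λ Ps → s≢s₀ (P-unique Ps Ps₀))
  (indicator-yes (P? s₀) Ps₀)
... | no ¬∃P = sum-zero _ λ s → indicator-no (P? s) λ Ps → ¬∃P (s , Ps)

Matrix : ℕ → Set
Matrix n = Fin n → Fin n → ℕ

module _ {n : ℕ} where

  infix  4 _≈ᴹ_
  infixl 6 _⊕_
  infixl 7 _⊗_

  _≈ᴹ_ : Rel (Matrix n) 0ℓ
  A ≈ᴹ B = ∀ i j → A i j ≡ B i j

  _⊕_ : Matrix n → Matrix n → Matrix n
  (A ⊕ B) i j = A i j ℕ.+ B i j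

  _⊗_ : Matrix n → Matrix n → Matrix n
  (A ⊗ B) i j = sum λ k → A i k ℕ.* B k j

  𝟘 : Matrix n
  𝟘 _ _ = 0

  𝟙 : Matrix n
  𝟙 i j = indicator (i Fin.≟ j)

  𝟙-permute : ∀ (π : Permutation′ n) v w → 𝟙 (π ⟨$⟩ʳ v) (π ⟨$⟩ʳ w) ≡ 𝟙 v w
  𝟙-permute π v w = indicator-cong (π ⟨$⟩ʳ v Fin.≟ π ⟨$⟩ʳ w) (v Fin.≟ w)
    (Injection.injective (↔⇒↣ π)) (cong (π ⟨$⟩ʳ_))

  ⊗-identityˡ : ∀ A → 𝟙 ⊗ A ≈ᴹ A
  ⊗-identityˡ A i j = begin
    sum (λ k → 𝟙 i k ℕ.* A k j)
      ≡⟨ sum-single _ i (λ k k≢i → cong (ℕ._* A k j) (indicator-no (i Fin.≟ k) (k≢i ∘ sym))) ⟩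
    𝟙 i i ℕ.* A i j              ≡⟨ cong (ℕ._* A i j) (indicator-yes (i Fin.≟ i) refl) ⟩
    1 ℕ.* A i j                  ≡⟨ ℕ.*-identityˡ (A i j) ⟩
    A i j                        ∎
    where open ≡-Reasoning

  ⊗-identityʳ : ∀ A → A ⊗ 𝟙 ≈ᴹ A
  ⊗-identityʳ A i j = begin
    sum (λ k → A i k ℕ.* 𝟙 k j)
      ≡⟨ sum-single _ j (λ k k≢j → trans (cong (A i k ℕ.*_) (indicator-no (k Fin.≟ j) k≢j)) (ℕ.*-zeroʳ (A i k))) ⟩
    A i j ℕ.* 𝟙 j j              ≡⟨ cong (A i j ℕ.*_) (indicator-yes (j Fin.≟ j) refl) ⟩
    A i j ℕ.* 1                  ≡⟨ ℕ.*-identityʳ (A i j) ⟩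
    A i j                        ∎
    where open ≡-Reasoning

  ⊗-assoc : ∀ A B C → (A ⊗ B) ⊗ C ≈ᴹ A ⊗ (B ⊗ C)
  ⊗-assoc A B C i j = begin
    sum (λ k → sum (λ l → A i l ℕ.* B l k) ℕ.* C k j)
      ≡⟨ sum-cong-≗ (λ k → *-distribʳ-sum (C k j) (λ l → A i l ℕ.* B l k)) ⟩
    sum (λ k → sum (λ l → A i l ℕ.* B l k ℕ.* C k j))
      ≡⟨ ∑-comm (λ k l → A i l ℕ.* B l k ℕ.* C k j) ⟩
    sum (λ l → sum (λ k → A i l ℕ.* B l k ℕ.* C k j))
      ≡⟨ sum-cong-≗ (λ l → sum-cong-≗ (λ k → ℕ.*-assoc (A i l) (B l k) (C k j))) ⟩
    sum (λ l → sum (λ k → A i l ℕ.* (B l k ℕ.* C k j)))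
      ≡⟨ sum-cong-≗ (λ l → *-distribˡ-sum (A i l) (λ k → B l k ℕ.* C k j)) ⟨
    sum (λ l → A i l ℕ.* sum (λ k → B l k ℕ.* C k j))
      ∎
    where open ≡-Reasoning

  ⊗-distribˡ-⊕ : ∀ A B C → A ⊗ (B ⊕ C) ≈ᴹ A ⊗ B ⊕ A ⊗ C
  ⊗-distribˡ-⊕ A B C i j = trans (sum-cong-≗ λ k → ℕ.*-distribˡ-+ (A i k) (B k j) (C k j))
                                 (∑-distrib-+ (λ k → A i k ℕ.* B k j) (λ k → A i k ℕ.* C k j))

  ⊗-distribʳ-⊕ : ∀ A B C → (B ⊕ C) ⊗ A ≈ᴹ B ⊗ A ⊕ C ⊗ A
  ⊗-distribʳ-⊕ A B C i j = trans (sum-cong-≗ λ k → ℕ.*-distribʳ-+ (A k j) (B i k) (C i k))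
                                 (∑-distrib-+ (λ k → B i k ℕ.* A k j) (λ k → C i k ℕ.* A k j))

  ⊗-zeroˡ : ∀ A → 𝟘 ⊗ A ≈ᴹ 𝟘
  ⊗-zeroˡ A i j = sum-zero (λ k → 0 ℕ.* A k j) λ _ → refl

  ⊗-zeroʳ : ∀ A → A ⊗ 𝟘 ≈ᴹ 𝟘
  ⊗-zeroʳ A i j = sum-zero (λ k → A i k ℕ.* 0) λ k → ℕ.*-zeroʳ (A i k)

  ⊗-isSemiring : IsSemiring _≈ᴹ_ _⊕_ _⊗_ 𝟘 𝟙
  ⊗-isSemiring = record
    { isSemiringWithoutAnnihilatingZero = record
      { +-isCommutativeMonoid = Pointwise.isCommutativeMonoid (Fin n)
          (Pointwise.isCommutativeMonoid (Fin n) ℕ.+-0-isCommutativeMonoid)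
      ; *-cong = λ A≈A′ B≈B′ i j → sum-cong-≗ λ k → cong₂ ℕ._*_ (A≈A′ i k) (B≈B′ k j)
      ; *-assoc = ⊗-assoc
      ; *-identity = ⊗-identityˡ , ⊗-identityʳ
      ; distrib = ⊗-distribˡ-⊕ , ⊗-distribʳ-⊕
      }
    ; zero = ⊗-zeroˡ , ⊗-zeroʳ
    }

matrixSemiring : ℕ → Semiring 0ℓ 0ℓ
matrixSemiring n = record { isSemiring = ⊗-isSemiring {n} }

module _ {n : ℕ} where

  open import Data.Integer using (_+_; _*_)
  open import Algebra.Properties.Semiring.Exp (matrixSemiring n) using (_^_)
  open import Algebra.Properties.Semiring.Mult (matrixSemiring n) using () renaming (_×_ to _·_)
  open import Algebra.Properties.Semiring.Sum (matrixSemiring n) using () renaming (sum to ∑ᴹ)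

  ∑ᴹ-apply : ∀ {k} (f : Fin k → Matrix n) x y → ∑ᴹ f x y ≡ sum (λ s → f s x y)
  ∑ᴹ-apply {zero}  f x y = refl
  ∑ᴹ-apply {suc k} f x y = cong (f Fin.zero x y ℕ.+_) (∑ᴹ-apply (f ∘ Fin.suc) x y)

  ·-apply : ∀ k A x y → (k · A) x y ≡ k ℕ.* A x y
  ·-apply zero    A x y = refl
  ·-apply (suc k) A x y = cong (A x y ℕ.+_) (·-apply k A x y)

  selectIf : {P : Set} → Dec P → Matrix n → Matrix n
  selectIf (yes _) A = A
  selectIf (no _)  _ = 𝟘

  selectIf-comm : ∀ {P Q : Set} (P? : Dec P) (Q? : Dec Q) {A B} → A ⊗ B ≈ᴹ B ⊗ A →
                  selectIf P? A ⊗ selectIf Q? B ≈ᴹ selectIf Q? B ⊗ selectIf P? A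
  selectIf-comm (yes _) (yes _) AB≈BA = AB≈BA
  selectIf-comm (yes _) (no _) {A} _ i j = trans (⊗-zeroʳ A i j) (sym (⊗-zeroˡ A i j))
  selectIf-comm (no _) (yes _) {B = B} _ i j = trans (⊗-zeroˡ B i j) (sym (⊗-zeroʳ B i j))
  selectIf-comm (no _) (no _) _ i j = refl

  selectIf-^ : ∀ {P : Set} (P? : Dec P) A k .{{_ : NonZero k}} → selectIf P? A ^ k ≈ᴹ selectIf P? (A ^ k)
  selectIf-^ (yes _) A k         i j = refl
  selectIf-^ (no _)  A (suc k)       = ⊗-zeroˡ (𝟘 ^ k)

  ChainInvariant : Rel (Fin n) 0ℓ → (ℤ → Permutation′ n) → Set
  ChainInvariant R σ = ∀ i v w →
    (R v w → R (σ i ⟨$⟩ʳ v) (σ (i + 1ℤ) ⟨$⟩ʳ w)) ×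
    (R (σ i ⟨$⟩ʳ v) (σ (i + 1ℤ) ⟨$⟩ʳ w) → R v w)

  adjacency : {R : Rel (Fin n) 0ℓ} → Decidable R → Matrix n
  adjacency R? v w = indicator (R? v w)

  walks-invariant : ∀ {R} (R? : Decidable R) {σ} → ChainInvariant R σ →
    ∀ k i v w → (adjacency R? ^ k) (σ i ⟨$⟩ʳ v) (σ (i + + k) ⟨$⟩ʳ w) ≡ (adjacency R? ^ k) v w
  walks-invariant R? {σ} σ-inv zero i v w = trans
    (cong (λ t → 𝟙 (σ i ⟨$⟩ʳ v) (σ t ⟨$⟩ʳ w)) (ℤ.+-identityʳ i))
    (𝟙-permute (σ i) v w)
  walks-invariant R? {σ} σ-inv (suc k) i v w = begin
    sum (λ z → A v′ z ℕ.* (A ^ k) z w′)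
      ≡⟨ sum-permute _ next ⟩
    sum (λ z → A v′ (next ⟨$⟩ʳ z) ℕ.* (A ^ k) (next ⟨$⟩ʳ z) w′)
      ≡⟨ sum-cong-≗ (λ z → cong₂ ℕ._*_ (edge-invariant z) (walks-invariant-from-next z)) ⟩
    sum (λ z → A v z ℕ.* (A ^ k) z w)
      ∎
    where
    open ≡-Reasoning
    A = adjacency R?
    v′ = σ i ⟨$⟩ʳ v
    w′ = σ (i + + suc k) ⟨$⟩ʳ w
    next = σ (i + 1ℤ)
    edge-invariant : ∀ z → A v′ (next ⟨$⟩ʳ z) ≡ A v z
    edge-invariant z = let fwd , bwd = σ-inv i v z in indicator-cong (R? _ _) (R? v z) bwd fwd
    walks-invariant-from-next : ∀ z → (A ^ k) (next ⟨$⟩ʳ z) w′ ≡ (A ^ k) z w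
    walks-invariant-from-next z = trans
      (cong (λ t → (A ^ k) (next ⟨$⟩ʳ z) (σ t ⟨$⟩ʳ w)) (sym (ℤ.+-assoc i 1ℤ (+ k))))
      (walks-invariant R? {σ} σ-inv k (i + 1ℤ) z w)

  adjacency-≡-power-% : ∀ {R R′} (R? : Decidable R) (R′? : Decidable R′) p .{{_ : NonTrivial p}} →
    (∃ λ Z → adjacency R? ^ p ≈ᴹ adjacency R′? ⊕ p · Z) →
    ∀ v w → adjacency R′? v w ≡ ((adjacency R? ^ p) v w % p) {{nonTrivial⇒nonZero p}}
  adjacency-≡-power-% R? R′? p (Z , Aᵖ≈B⊕p·Z) v w = begin
    B v w                        ≡⟨ m<n⇒m%n≡m (ℕ.<-≤-trans (indicator<2 _) (nonTrivial⇒n>1 p)) ⟨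
    B v w % p                    ≡⟨ [m+kn]%n≡m%n (B v w) (Z v w) p ⟨
    (B v w ℕ.+ Z v w ℕ.* p) % p  ≡⟨ cong (λ t → (B v w ℕ.+ t) % p) Z*p≡p·Z ⟩
    (B ⊕ p · Z) v w % p          ≡⟨ cong (_% p) (Aᵖ≈B⊕p·Z v w) ⟨
    (adjacency R? ^ p) v w % p   ∎
    where
    open ≡-Reasoning
    instance _ = nonTrivial⇒nonZero p
    B = adjacency R′?
    Z*p≡p·Z : Z v w ℕ.* p ≡ (p · Z) v w
    Z*p≡p·Z = trans (ℕ.*-comm (Z v w) p) (sym (·-apply p Z v w))

  chainInvariant-power : ∀ {R R′} (R? : Decidable R) (R′? : Decidable R′) p .{{_ : NonTrivial p}} →
    (∃ λ Z → adjacency R? ^ p ≈ᴹ adjacency R′? ⊕ p · Z) →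
    ∀ {σ} → ChainInvariant R σ → ChainInvariant R′ (λ i → σ (i * + p))
  chainInvariant-power R? R′? p Aᵖ≡B {σ} σ-inv i v w =
    indicator-≡⇒ (R′? v w) (R′? _ _) (sym τ-invariant) , indicator-≡⇒ (R′? _ _) (R′? v w) τ-invariant
    where
    open ≡-Reasoning
    instance _ = nonTrivial⇒nonZero p
    Aᵖ = adjacency R? ^ p
    B = adjacency R′?
    B≡Aᵖ%p = adjacency-≡-power-% R? R′? p Aᵖ≡B
    v′ = σ (i * + p) ⟨$⟩ʳ v
    [i+1]p≡ip+p : ∀ i p → (i + 1ℤ) * p ≡ i * p + p
    [i+1]p≡ip+p = solve-∀
    τ-invariant : B v′ (σ ((i + 1ℤ) * + p) ⟨$⟩ʳ w) ≡ B v w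
    τ-invariant = begin
      B v′ (σ ((i + 1ℤ) * + p) ⟨$⟩ʳ w)        ≡⟨ B≡Aᵖ%p _ _ ⟩
      Aᵖ v′ (σ ((i + 1ℤ) * + p) ⟨$⟩ʳ w) % p   ≡⟨ cong (λ t → Aᵖ v′ (σ t ⟨$⟩ʳ w) % p) ([i+1]p≡ip+p i (+ p)) ⟩
      Aᵖ v′ (σ (i * + p + + p) ⟨$⟩ʳ w) % p    ≡⟨ cong (_% p) (walks-invariant R? {σ} σ-inv p (i * + p) v w) ⟩
      Aᵖ v w % p                              ≡⟨ B≡Aᵖ%p v w ⟨
      B v w                                   ∎

-- Adjacency matrices of Cayley digraphs

module _ {m : ℕ} .{{_ : NonZero m}} where

  open import Algebra.Properties.Semiring.Exp (matrixSemiring m) using (_^_; ^-congˡ)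
  open import Algebra.Properties.Semiring.Mult (matrixSemiring m) using () renaming (_×_ to _·_)
  open import Algebra.Properties.Semiring.Sum (matrixSemiring m) using (sum-cong-≋) renaming (sum to ∑ᴹ)
  open Semiring (matrixSemiring m) using (setoid; +-congʳ)
  open Frobenius (matrixSemiring m) using (frobenius-∑)

  translation : Fin m → Matrix m
  translation s x y = 𝟙 (x +ₘ s) y

  translation-⊗ : ∀ a b → translation a ⊗ translation b ≈ᴹ translation (a +ₘ b)
  translation-⊗ a b x y = begin
    sum (λ z → 𝟙 (x +ₘ a) z ℕ.* 𝟙 (z +ₘ b) y)
      ≡⟨ sum-single _ (x +ₘ a) (λ z z≢x+a → cong (ℕ._* _) (indicator-no (x +ₘ a Fin.≟ z) (z≢x+a ∘ sym))) ⟩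
    𝟙 (x +ₘ a) (x +ₘ a) ℕ.* 𝟙 ((x +ₘ a) +ₘ b) y
      ≡⟨ cong₂ ℕ._*_ (indicator-yes (x +ₘ a Fin.≟ x +ₘ a) refl) (cong (λ t → 𝟙 t y) (+ₘ-assoc x a b)) ⟩
    1 ℕ.* 𝟙 (x +ₘ (a +ₘ b)) y
      ≡⟨ ℕ.*-identityˡ _ ⟩
    𝟙 (x +ₘ (a +ₘ b)) y
      ∎
    where open ≡-Reasoning

  translation-comm : ∀ a b → translation a ⊗ translation b ≈ᴹ translation b ⊗ translation a
  translation-comm a b x y = begin
    (translation a ⊗ translation b) x y  ≡⟨ translation-⊗ a b x y ⟩
    translation (a +ₘ b) x y             ≡⟨ cong (λ t → translation t x y) (+ₘ-comm a b) ⟩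
    translation (b +ₘ a) x y             ≡⟨ translation-⊗ b a x y ⟨
    (translation b ⊗ translation a) x y  ∎
    where open ≡-Reasoning

  translation-^ : ∀ s k → translation s ^ k ≈ᴹ translation (ψ (+ k) s)
  translation-^ s zero x y = cong (λ t → 𝟙 t y) (sym (trans (cong (x +ₘ_) (ψ-zero s)) (+ₘ-identityʳ x)))
  translation-^ s (suc k) x y = begin
    sum (λ z → translation s x z ℕ.* (translation s ^ k) z y)
      ≡⟨ sum-cong-≗ (λ z → cong (translation s x z ℕ.*_) (translation-^ s k z y)) ⟩
    (translation s ⊗ translation (ψ (+ k) s)) x y
      ≡⟨ translation-⊗ s (ψ (+ k) s) x y ⟩
    translation (s +ₘ ψ (+ k) s) x y
      ≡⟨ cong (λ t → translation t x y) (ψ-1+ (+ k) s) ⟨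
    translation (ψ (+ suc k) s) x y
      ∎
    where open ≡-Reasoning

  Image : (Fin m → Fin m) → Pred (Fin m) 0ℓ → Pred (Fin m) 0ℓ
  Image f S y = ∃ λ s → S s × f s ≡ y

  image? : ∀ {S} f → U.Decidable S → U.Decidable (Image f S)
  image? f S? y = Fin.any? λ s → S? s ×-dec (f s Fin.≟ y)

  cayley? : ∀ {S : Pred (Fin m) 0ℓ} → U.Decidable S → Decidable (λ x y → S (y -ₘ x))
  cayley? S? x y = S? (y -ₘ x)

  selectIf-translation : ∀ {S : Pred (Fin m) 0ℓ} (S? : U.Decidable S) s t x y →
    selectIf (S? s) (translation t) x y ≡ indicator (S? s ×-dec (t Fin.≟ y -ₘ x))
  selectIf-translation S? s t x y with S? s
  ... | yes Ss = indicator-cong (x +ₘ t Fin.≟ y) (yes Ss ×-dec (t Fin.≟ y -ₘ x))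
    (λ x+t≡y → Ss , trans (sym ([x+s]-x≡s x t)) (cong (_-ₘ x) x+t≡y))
    (λ (_ , t≡y-x) → trans (cong (x +ₘ_) t≡y-x) (x+[y-x]≡y x y))
  ... | no ¬Ss = sym (indicator-no (no ¬Ss ×-dec (t Fin.≟ y -ₘ x)) (¬Ss ∘ proj₁))

  adjacency-image : ∀ {S : Pred (Fin m) 0ℓ} (S? : U.Decidable S) {f} → (∀ {s t} → f s ≡ f t → s ≡ t) →
    adjacency (cayley? (image? f S?)) ≈ᴹ ∑ᴹ (λ s → selectIf (S? s) (translation (f s)))
  adjacency-image S? {f} f-injective x y = sym (begin
    ∑ᴹ (λ s → selectIf (S? s) (translation (f s))) x y
      ≡⟨ ∑ᴹ-apply (λ s → selectIf (S? s) (translation (f s))) x y ⟩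
    sum (λ s → selectIf (S? s) (translation (f s)) x y)
      ≡⟨ sum-cong-≗ (λ s → selectIf-translation S? s (f s) x y) ⟩
    sum (λ s → indicator (S? s ×-dec (f s Fin.≟ y -ₘ x)))
      ≡⟨ sum-indicator _ (λ (_ , fs≡y-x) (_ , ft≡y-x) → f-injective (trans fs≡y-x (sym ft≡y-x))) ⟩
    indicator (image? f S? (y -ₘ x))
      ∎)
    where open ≡-Reasoning

  adjacency-cayley : ∀ {S : Pred (Fin m) 0ℓ} (S? : U.Decidable S) →
    adjacency (cayley? S?) ≈ᴹ ∑ᴹ (λ s → selectIf (S? s) (translation s))
  adjacency-cayley {S} S? x y = trans
    (indicator-cong (S? (y -ₘ x)) (image? id S? (y -ₘ x))
      (λ Sy-x → _ , Sy-x , refl) (λ (_ , Ss , s≡y-x) → subst S s≡y-x Ss))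
    (adjacency-image S? id x y)

  cayley-frobenius : ∀ {S : Pred (Fin m) 0ℓ} (S? : U.Decidable S) {p} → Prime p →
    (∀ {s t} → ψ (+ p) s ≡ ψ (+ p) t → s ≡ t) →
    ∃ λ Z → adjacency (cayley? S?) ^ p ≈ᴹ adjacency (cayley? (image? (ψ (+ p)) S?)) ⊕ p · Z
  cayley-frobenius S? {p} p-prime ψp-injective = Z , (begin
    adjacency (cayley? S?) ^ p                                    ≈⟨ ^-congˡ p (adjacency-cayley S?) ⟩
    ∑ᴹ T ^ p                                                      ≈⟨ ∑Tᵖ≈ ⟩
    ∑ᴹ (λ s → T s ^ p) ⊕ p · Z                                    ≈⟨ +-congʳ (sum-cong-≋ Tᵖ≈) ⟩
    ∑ᴹ (λ s → selectIf (S? s) (translation (ψ (+ p) s))) ⊕ p · Z  ≈⟨ +-congʳ (adjacency-image S? ψp-injective) ⟨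
    adjacency (cayley? (image? (ψ (+ p)) S?)) ⊕ p · Z             ∎)
    where
    open import Relation.Binary.Reasoning.Setoid setoid
    instance _ = prime⇒nonZero p-prime
    T = λ s → selectIf (S? s) (translation s)
    open Σ (frobenius-∑ p-prime T λ s t → selectIf-comm (S? s) (S? t) (translation-comm s t))
      renaming (proj₁ to Z; proj₂ to ∑Tᵖ≈)
    Tᵖ≈ : ∀ s → T s ^ p ≈ᴹ selectIf (S? s) (translation (ψ (+ p) s))
    Tᵖ≈ s with S? s
    ... | yes _ = translation-^ s p
    ... | no ¬Ss = selectIf-^ (no ¬Ss) (translation s) p

-- Scaling the connection sets

module _ {m : ℕ} .{{_ : NonZero m}} where

  open import Data.Integer using (_*_; -_)

  DecidableConnSets : ∀ {k} → ConnSets k m → Set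
  DecidableConnSets S = ∀ j → U.Decidable (S j)

  scaleSets? : ∀ {k} l {S : ConnSets k m} → DecidableConnSets S → DecidableConnSets (scaleSets l S)
  scaleSets? l S? j = image? (ψ l) (S? j)

  ∈AutCh-DiCay-resp-≐ : ∀ {k} (S S′ : ConnSets k m) → (∀ j → S j ≐ S′ j) →
                        ∀ φ → φ ∈AutCh DiCay S → φ ∈AutCh DiCay S′
  ∈AutCh-DiCay-resp-≐ S S′ S≐S′ = ∈AutCh-resp-⇔ (DiCay S) (DiCay S′) λ j → proj₁ (S≐S′ j) , proj₂ (S≐S′ j)

  scaleSets-∘ : ∀ {k} a b (S : ConnSets k m) j → scaleSets a (scaleSets b S) j ≐ scaleSets (a * b) S j
  scaleSets-∘ a b S j =
    (λ (_ , (s , Ss , ψbs≡t) , ψat≡y) → s , Ss , trans (sym (ψ-∘ a b s)) (trans (cong (ψ a) ψbs≡t) ψat≡y)) ,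
    (λ (s , Ss , ψabs≡y) → ψ b s , (s , Ss , refl) , trans (ψ-∘ a b s) ψabs≡y)

  scaleSets-cong : ∀ {k a b} → a ≡ b [mod + m ] → (S : ConnSets k m) →
                   ∀ j → scaleSets a S j ≐ scaleSets b S j
  scaleSets-cong a≡b S j =
    (λ (s , Ss , ψas≡y) → s , Ss , trans (sym (ψ-cong a≡b s)) ψas≡y) ,
    (λ (s , Ss , ψbs≡y) → s , Ss , trans (ψ-cong a≡b s) ψbs≡y)

  scaleSets-identity : ∀ {k} (S : ConnSets k m) j → scaleSets 1ℤ S j ≐ S j
  scaleSets-identity S j =
    (λ (s , Ss , s≡y) → subst (S j) (trans (sym (ψ-identity s)) s≡y) Ss) ,
    (λ {y} Sy → y , Sy , ψ-identity y)

  DiCay-neg⇔reverse : ∀ {k} (S : ConnSets k m) j → E (DiCay (scaleSets -1ℤ S)) j ⇔ E (reverse (DiCay S)) j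
  DiCay-neg⇔reverse S j =
    (λ {x} {y} (s , Ss , ψs≡y-x) → subst (S j) (ψ-injective -1ℤ-invertible (trans ψs≡y-x (sym (ψ-neg y x)))) Ss) ,
    (λ {x} {y} Sx-y → x -ₘ y , Sx-y , ψ-neg y x)
    where
    -1ℤ-invertible : Invertible -1ℤ
    -1ℤ-invertible = invertible -1ℤ (≡-mod-refl 1ℤ)

  ScalingPreservesAutCh : ℤ → Set₁
  ScalingPreservesAutCh l = ∀ {k} (S : ConnSets k m) → DecidableConnSets S →
    ∀ φ → φ ∈AutCh DiCay S → φ ∈AutCh DiCay (scaleSets l S)

  scaling-identity : ScalingPreservesAutCh 1ℤ
  scaling-identity S _ = ∈AutCh-DiCay-resp-≐ S (scaleSets 1ℤ S) (swap ∘ scaleSets-identity S)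

  scaling-cong : ∀ {a b} → a ≡ b [mod + m ] → ScalingPreservesAutCh a → ScalingPreservesAutCh b
  scaling-cong {a} {b} a≡b a-scaling S S? φ =
    ∈AutCh-DiCay-resp-≐ (scaleSets a S) (scaleSets b S) (scaleSets-cong a≡b S) φ ∘ a-scaling S S? φ

  scaling-* : ∀ {a b} → ScalingPreservesAutCh a → ScalingPreservesAutCh b → ScalingPreservesAutCh (a * b)
  scaling-* {a} {b} a-scaling b-scaling S S? φ =
    ∈AutCh-DiCay-resp-≐ (scaleSets a (scaleSets b S)) (scaleSets (a * b) S) (scaleSets-∘ a b S) φ
    ∘ a-scaling (scaleSets b S) (scaleSets? b S?) φ
    ∘ b-scaling S S? φ

  scaling-neg : ScalingPreservesAutCh -1ℤ
  scaling-neg S _ φ =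
    ∈AutCh-resp-⇔ (reverse (DiCay S)) (DiCay (scaleSets -1ℤ S)) (swap ∘ DiCay-neg⇔reverse S) φ
    ∘ ∈AutCh-reverse (DiCay S) φ

  scaling-prime : ∀ {p} → Prime p → Invertible (+ p) → ScalingPreservesAutCh (+ p)
  scaling-prime {p} p-prime p-invertible S S? _ (σ , σ-aut , σ₀≈φ) = (λ i → σ (i * + p)) , τ-aut , σ₀≈φ
    where
    instance _ = prime⇒nonTrivial p-prime
    τ-aut : IsChainAut (DiCay (scaleSets (+ p) S)) (λ i → σ (i * + p))
    τ-aut i j = chainInvariant-power (cayley? (S? j)) (cayley? (image? (ψ (+ p)) (S? j))) p
      (cayley-frobenius (S? j) p-prime (ψ-injective p-invertible)) {σ} (λ i → σ-aut i j) i

  scaling-primeProduct : ∀ {ps} → All Prime ps → Invertible (+ product ps) → ScalingPreservesAutCh (+ product ps)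
  scaling-primeProduct [] _ = scaling-identity
  scaling-primeProduct {p ∷ ps} (p-prime ∷ ps-prime) p*ps-invertible =
    scaling-cong (≡-mod-reflexive (sym (ℤ.pos-* p (product ps))))
      (scaling-* {+ p} {+ product ps}
        (scaling-prime p-prime (invertible-*ˡ (+ p) _ u))
        (scaling-primeProduct ps-prime (invertible-*ʳ (+ p) _ u)))
    where
    u : Invertible (+ p * + product ps)
    u = subst Invertible (ℤ.pos-* p (product ps)) p*ps-invertible

  -- The factorisation is an argument so that `factorise n` is never unfolded during type checking.
  scaling-factorisation : ∀ {n} → PrimeFactorisation n → Invertible (+ n) → ScalingPreservesAutCh (+ n)
  scaling-factorisation F n-invertible =
    subst (ScalingPreservesAutCh ∘ +_) (sym isFactorisation)
      (scaling-primeProduct factorsPrime (subst (Invertible ∘ +_) isFactorisation n-invertible))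
    where open PrimeFactorisation F

  scaling-invertible-ℕ : ∀ n → Invertible (+ n) → ScalingPreservesAutCh (+ n)
  scaling-invertible-ℕ zero (invertible u u*0≡1) = scaling-cong 1≡0 scaling-identity
    where
    1≡0 : 1ℤ ≡ 0ℤ [mod + m ]
    1≡0 = ≡-mod-sym (subst (_≡ 1ℤ [mod + m ]) (ℤ.*-zeroʳ u) u*0≡1)
  scaling-invertible-ℕ n@(suc _) = scaling-factorisation (factorise n)

  scaling-invertible : ∀ {l} → Invertible l → ScalingPreservesAutCh l
  scaling-invertible {+ n} = scaling-invertible-ℕ n
  scaling-invertible { -[1+ n ]} l-invertible =
    scaling-cong (≡-mod-reflexive (ℤ.-1*i≡-i (+ suc n)))
      (scaling-* { -1ℤ} {+ suc n} scaling-neg (scaling-invertible-ℕ (suc n) (invertible-neg l-invertible)))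

  AutCh-scaling : ∀ {l} → Invertible l → ∀ {k} (S : ConnSets k m) → DecidableConnSets S → ∀ φ →
    (φ ∈AutCh DiCay S → φ ∈AutCh DiCay (scaleSets l S)) ×
    (φ ∈AutCh DiCay (scaleSets l S) → φ ∈AutCh DiCay S)
  AutCh-scaling {l} u@(invertible l′ l′l≡1) S S? φ =
    scaling-invertible u S S? φ ,
    ∈AutCh-DiCay-resp-≐ (scaleSets l′ (scaleSets l S)) S l′lS≐S φ
    ∘ scaling-invertible (inverse-invertible u) (scaleSets l S) (scaleSets? l S?) φ
    where
    l′lS≐S : ∀ j → scaleSets l′ (scaleSets l S) j ≐ S j
    l′lS≐S j = ≐-trans (scaleSets-∘ l′ l S j) (≐-trans (scaleSets-cong l′l≡1 S j) (scaleSets-identity S j))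

  ψ-permutation : ∀ {l} → Invertible l → Permutation′ m
  ψ-permutation {l} u =
    permutation (ψ l) (ψ (Invertible.inverse u)) (ψ-inverseˡ (inverse-invertible u)) (ψ-inverseˡ u)

  ψ-isIsomorphism : ∀ {l} (u : Invertible l) {k} (S : ConnSets k m) →
    IsIsomorphism (DiCay S) (DiCay (scaleSets l S)) (ψ-permutation u)
  ψ-isIsomorphism {l} u S j v w =
    (λ Sw-v → w -ₘ v , Sw-v , ψ-distrib--ₘ l v w) ,
    (λ (s , Ss , ψs≡) → subst (S j) (ψ-injective u (trans ψs≡ (sym (ψ-distrib--ₘ l v w)))) Ss)

lemma3p13 : (k m : ℕ) .{{_ : NonZero m}} (S : Fin k → Subset m) →
    Reduced S →
    (l : ℤ) → Coprime ∣ l ∣ m →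
    -- Aut^Ch(Γ) = Aut^Ch(Γ^(l))
    (∀ (φ : Permutation′ m) →
      (φ ∈AutCh DiCay (asConn S) → φ ∈AutCh DiCayScaled l S) ×
      (φ ∈AutCh DiCayScaled l S → φ ∈AutCh DiCay (asConn S))) ×
    -- ψ_l is a permutation Ψ of ℤ_m, and φ ↦ Ψ ∘ φ ∘ Ψ⁻¹ is an automorphism of Aut^Ch(Γ)
    Σ (Permutation′ m) (λ Ψ →
      (∀ x → Ψ ⟨$⟩ʳ x ≡ ψ l x) ×
      (∀ φ → φ ∈AutCh DiCay (asConn S) → conj Ψ φ ∈AutCh DiCay (asConn S)) ×
      (∀ φ → φ ∈AutCh DiCay (asConn S) →
        ∃ λ φ′ → φ′ ∈AutCh DiCay (asConn S) × (conj Ψ φ′ ≈ₚ φ)) ×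
      (∀ φ φ′ → conj Ψ φ ≈ₚ conj Ψ φ′ → φ ≈ₚ φ′) ×
      (∀ φ φ′ → conj Ψ (φ ∘ₚ φ′) ≈ₚ (conj Ψ φ ∘ₚ conj Ψ φ′)))
lemma3p13 k m S _ l l⊥m =
  AutCh-scaling u Γ-sets S? ,
  Ψ , (λ _ → refl) , conj-closed , conj-surjective , conj-injective Ψ , conj-∘ₚ Ψ
  where
  u = coprime⇒invertible l l⊥m
  Γ-sets = asConn S
  Γ = DiCay Γ-sets
  Γˡ = DiCayScaled l S
  S? : DecidableConnSets Γ-sets
  S? j x = x ∈? S j
  Ψ = ψ-permutation u
  Ψ-iso = ψ-isIsomorphism u Γ-sets
  conj-closed : ∀ φ → φ ∈AutCh Γ → conj Ψ φ ∈AutCh Γ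
  conj-closed φ = proj₂ (AutCh-scaling u Γ-sets S? (conj Ψ φ)) ∘ conj-∈AutCh Γ Γˡ Ψ Ψ-iso φ
  conj-surjective : ∀ φ → φ ∈AutCh Γ → ∃ λ φ′ → φ′ ∈AutCh Γ × (conj Ψ φ′ ≈ₚ φ)
  conj-surjective φ φ∈ =
    conj (flip Ψ) φ ,
    conj-∈AutCh Γˡ Γ (flip Ψ) (isomorphism-flip Γ Γˡ Ψ Ψ-iso) φ
      (proj₁ (AutCh-scaling u Γ-sets S? φ) φ∈) ,
    conj-flip Ψ φ
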